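{- The group $H$ has presentation $\langle x,y \mid y^2\rangle$ (with $x$ corresponding to $B$ and $y$ to $J$), hence $H$ is isomorphic to the free product $\mathbb{Z}*\mathbb{Z}/2\mathbb{Z}$.
   Context: Let $B=\begin{pmatrix}3&4&0\\2&3&0\\0&0&1\end{pmatrix}$, $J=\begin{pmatrix}0&0&1\\0&1&0\\1&0&0\end{pmatrix}$, and let $H$ be the subgroup of $\mathrm{GL}_3(\mathbb{Z})$ generated by $B$ and $J$. -}

module Defs where

open import Data.Integer using (ℤ; +_; -_; _+_; _*_)
open import Data.Bool using (Bool; true; false; not)
open import Data.List using (List; []; _∷_; _++_; foldr)
open import Data.Product using (_×_; _,_)
open import Data.Vec using (Vec; []; _∷_)
open import Relation.Binary.PropositionalEquality using (_≡_; refl)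

-- 3×3 integer matrices, as three rows of three entries.
Mat3 : Set
Mat3 = Vec (Vec ℤ 3) 3

mat : ℤ → ℤ → ℤ → ℤ → ℤ → ℤ → ℤ → ℤ → ℤ → Mat3
mat a b c d e f g h i = (a ∷ b ∷ c ∷ []) ∷ (d ∷ e ∷ f ∷ []) ∷ (g ∷ h ∷ i ∷ []) ∷ []

_⊗_ : Mat3 → Mat3 → Mat3
((a ∷ b ∷ c ∷ []) ∷ (d ∷ e ∷ f ∷ []) ∷ (g ∷ h ∷ i ∷ []) ∷ [])
  ⊗ ((a' ∷ b' ∷ c' ∷ []) ∷ (d' ∷ e' ∷ f' ∷ []) ∷ (g' ∷ h' ∷ i' ∷ []) ∷ []) =
  mat (a * a' + b * d' + c * g') (a * b' + b * e' + c * h') (a * c' + b * f' + c * i')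
      (d * a' + e * d' + f * g') (d * b' + e * e' + f * h') (d * c' + e * f' + f * i')
      (g * a' + h * d' + i * g') (g * b' + h * e' + i * h') (g * c' + h * f' + i * i')

I₃ : Mat3
I₃ = mat (+ 1) (+ 0) (+ 0) (+ 0) (+ 1) (+ 0) (+ 0) (+ 0) (+ 1)

B : Mat3
B = mat (+ 3) (+ 4) (+ 0) (+ 2) (+ 3) (+ 0) (+ 0) (+ 0) (+ 1)

B⁻¹ : Mat3
B⁻¹ = mat (+ 3) (- (+ 4)) (+ 0) (- (+ 2)) (+ 3) (+ 0) (+ 0) (+ 0) (+ 1)

J : Mat3
J = mat (+ 0) (+ 0) (+ 1) (+ 0) (+ 1) (+ 0) (+ 1) (+ 0) (+ 0)

B⊗B⁻¹ : B ⊗ B⁻¹ ≡ I₃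
B⊗B⁻¹ = refl

B⁻¹⊗B : B⁻¹ ⊗ B ≡ I₃
B⁻¹⊗B = refl

J⊗J : J ⊗ J ≡ I₃
J⊗J = refl

-- Generators x, y of the free group F(x,y); a letter is a generator with an
-- exponent sign (true = +1, false = -1); words are lists of letters.
data Gen : Set where
  gx gy : Gen

Letter : Set
Letter = Gen × Bool

Word : Set
Word = List Letter

inv : Letter → Letter
inv (g , s) = (g , not s)

y : Letter
y = (gy , true)

-- Equality in the group ⟨ x , y ∣ y² ⟩: the congruence on words generated by
-- free cancellation (l l⁻¹ = 1) and the relator y² = 1.
data _≈ₚ_ : Word → Word → Set where
  ≈-refl  : ∀ {u} → u ≈ₚ u
  ≈-sym   : ∀ {u v} → u ≈ₚ v → v ≈ₚ u
  ≈-trans : ∀ {u v w} → u ≈ₚ v → v ≈ₚ w → u ≈ₚ w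
  ≈-free  : ∀ u v l → (u ++ l ∷ inv l ∷ v) ≈ₚ (u ++ v)
  ≈-rel   : ∀ u v → (u ++ y ∷ y ∷ v) ≈ₚ (u ++ v)

-- The homomorphism F(x,y) → GL₃(ℤ), x ↦ B, y ↦ J (its image is H = ⟨B, J⟩).
evalL : Letter → Mat3
evalL (gx , true)  = B
evalL (gx , false) = B⁻¹
evalL (gy , true)  = J
evalL (gy , false) = J

eval : Word → Mat3
eval = foldr (λ l M → evalL l ⊗ M) I₃

module Submission where

-- Matrices act on ℤ³ multiplicatively and faithfully, so it
-- suffices that deleting l l⁻¹ or y y from a word does not change how the
-- word acts, which holds because B B⁻¹ = B⁻¹ B = J J = I₃.
--
-- Completeness: rewriting letter by letter, every word equals a reduced word
-- in x, x⁻¹, y (no x x⁻¹, x⁻¹ x, y y), and a nonempty reduced word does not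
-- evaluate to I₃.  The latter is the ping-pong lemma, proved abstractly for
-- any action with three pairwise disjoint nonempty regions such that each
-- letter maps the region of every letter allowed to its right into its own.
-- The regions in ℤ³ are all cut out by one cone; the reflection
-- diag(-1,1,1), which conjugates B to B⁻¹, and the symmetry c ↦ -c reduce
-- the required inequalities to two explicit positivity computations for B.

open import Defs
open import Relation.Binary.PropositionalEquality
  using (_≡_; _≢_; refl; sym; trans; cong; cong₂; subst; module ≡-Reasoning)
open import Relation.Nullary using (yes; no)
open import Relation.Nullary.Decidable using (Dec)
open import Data.Product using (Σ; _×_; _,_)
open import Data.Sum using (_⊎_; inj₁; inj₂)
open import Data.Empty using (⊥; ⊥-elim)
open import Data.Unit using (⊤; tt)
open import Data.Bool using (true; false)
open import Data.List using (List; []; _∷_; _++_; foldr; map)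
open import Data.List.Properties using (foldr-++)
open import Data.Vec using () renaming ([] to []ᵥ; _∷_ to _∷ᵥ_)
open import Data.Integer using (ℤ; +_; -_; _+_; _*_; _-_; _<_; +<+)
open import Data.Integer.Properties using (+-mono-<; <-irrefl; neg-involutive)
open import Data.Integer.Tactic.RingSolver using (solve-∀)
import Data.Nat as ℕ

triple≡ : ∀ {A : Set} {x x′ y y′ z z′ : A} →
          x ≡ x′ → y ≡ y′ → z ≡ z′ → (x , y , z) ≡ (x′ , y′ , z′)
triple≡ refl refl refl = refl

pattern matrix m₁ m₂ m₃ m₄ m₅ m₆ m₇ m₈ m₉ =
  (m₁ ∷ᵥ m₂ ∷ᵥ m₃ ∷ᵥ []ᵥ) ∷ᵥ (m₄ ∷ᵥ m₅ ∷ᵥ m₆ ∷ᵥ []ᵥ) ∷ᵥ (m₇ ∷ᵥ m₈ ∷ᵥ m₉ ∷ᵥ []ᵥ) ∷ᵥ []ᵥ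

V3 : Set
V3 = ℤ × ℤ × ℤ

act : Mat3 → V3 → V3
act (matrix m₁ m₂ m₃ m₄ m₅ m₆ m₇ m₈ m₉) (a , b , c) =
  m₁ * a + m₂ * b + m₃ * c , m₄ * a + m₅ * b + m₆ * c , m₇ * a + m₈ * b + m₉ * c

-- One entry of (M N) v = M (N v): a row of M, all of N, and v.
row-assoc : ∀ m₁ m₂ m₃ n₁ n₂ n₃ n₄ n₅ n₆ n₇ n₈ n₉ a b c →
  (m₁ * n₁ + m₂ * n₄ + m₃ * n₇) * a + (m₁ * n₂ + m₂ * n₅ + m₃ * n₈) * b
    + (m₁ * n₃ + m₂ * n₆ + m₃ * n₉) * c
  ≡ m₁ * (n₁ * a + n₂ * b + n₃ * c) + m₂ * (n₄ * a + n₅ * b + n₆ * c)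
    + m₃ * (n₇ * a + n₈ * b + n₉ * c)
row-assoc = solve-∀

act-⊗ : ∀ M N v → act (M ⊗ N) v ≡ act M (act N v)
act-⊗ (matrix m₁ m₂ m₃ m₄ m₅ m₆ m₇ m₈ m₉) (matrix n₁ n₂ n₃ n₄ n₅ n₆ n₇ n₈ n₉) (a , b , c) =
  cong₂ _,_ (row-assoc m₁ m₂ m₃ n₁ n₂ n₃ n₄ n₅ n₆ n₇ n₈ n₉ a b c)
   (cong₂ _,_ (row-assoc m₄ m₅ m₆ n₁ n₂ n₃ n₄ n₅ n₆ n₇ n₈ n₉ a b c)
              (row-assoc m₇ m₈ m₉ n₁ n₂ n₃ n₄ n₅ n₆ n₇ n₈ n₉ a b c))

pick₁ : ∀ a b c → + 1 * a + + 0 * b + + 0 * c ≡ a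
pick₁ = solve-∀

pick₂ : ∀ a b c → + 0 * a + + 1 * b + + 0 * c ≡ b
pick₂ = solve-∀

pick₃ : ∀ a b c → + 0 * a + + 0 * b + + 1 * c ≡ c
pick₃ = solve-∀

act-I₃ : ∀ v → act I₃ v ≡ v
act-I₃ (a , b , c) = triple≡ (pick₁ a b c) (pick₂ a b c) (pick₃ a b c)

columns : Mat3 → V3 × V3 × V3
columns (matrix m₁ m₂ m₃ m₄ m₅ m₆ m₇ m₈ m₉) = (m₁ , m₄ , m₇) , (m₂ , m₅ , m₈) , (m₃ , m₆ , m₉)

columns-injective : ∀ M N → columns M ≡ columns N → M ≡ N
columns-injective (matrix _ _ _ _ _ _ _ _ _) (matrix _ _ _ _ _ _ _ _ _) refl = refl

e₁ e₂ e₃ : V3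
e₁ = + 1 , + 0 , + 0
e₂ = + 0 , + 1 , + 0
e₃ = + 0 , + 0 , + 1

select₁ : ∀ p q r → p * + 1 + q * + 0 + r * + 0 ≡ p
select₁ = solve-∀

select₂ : ∀ p q r → p * + 0 + q * + 1 + r * + 0 ≡ q
select₂ = solve-∀

select₃ : ∀ p q r → p * + 0 + q * + 0 + r * + 1 ≡ r
select₃ = solve-∀

act-basis : ∀ M → (act M e₁ , act M e₂ , act M e₃) ≡ columns M
act-basis (matrix m₁ m₂ m₃ m₄ m₅ m₆ m₇ m₈ m₉) =
  triple≡ (triple≡ (select₁ m₁ m₂ m₃) (select₁ m₄ m₅ m₆) (select₁ m₇ m₈ m₉))
          (triple≡ (select₂ m₁ m₂ m₃) (select₂ m₄ m₅ m₆) (select₂ m₇ m₈ m₉))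
          (triple≡ (select₃ m₁ m₂ m₃) (select₃ m₄ m₅ m₆) (select₃ m₇ m₈ m₉))

act-faithful : ∀ M N → (∀ v → act M v ≡ act N v) → M ≡ N
act-faithful M N same = columns-injective M N (begin
  columns M                              ≡⟨ sym (act-basis M) ⟩
  (act M e₁ , act M e₂ , act M e₃)       ≡⟨ triple≡ (same e₁) (same e₂) (same e₃) ⟩
  (act N e₁ , act N e₂ , act N e₃)       ≡⟨ act-basis N ⟩
  columns N                              ∎)
  where open ≡-Reasoning

run : Word → V3 → V3
run w v = foldr (λ l → act (evalL l)) v w

eval-act : ∀ w v → act (eval w) v ≡ run w v
eval-act []      v = act-I₃ v
eval-act (l ∷ w) v = trans (act-⊗ (evalL l) (eval w) v) (cong (act (evalL l)) (eval-act w v))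

letter-cancel : ∀ l v → run (l ∷ inv l ∷ []) v ≡ v
letter-cancel l v = begin
  act (evalL l) (act (evalL (inv l)) v)  ≡⟨ sym (act-⊗ (evalL l) (evalL (inv l)) v) ⟩
  act (evalL l ⊗ evalL (inv l)) v        ≡⟨ cong (λ M → act M v) (product-is-I₃ l) ⟩
  act I₃ v                               ≡⟨ act-I₃ v ⟩
  v                                      ∎
  where
  open ≡-Reasoning
  product-is-I₃ : ∀ l → evalL l ⊗ evalL (inv l) ≡ I₃
  product-is-I₃ (gx , true)  = refl
  product-is-I₃ (gx , false) = refl
  product-is-I₃ (gy , true)  = refl
  product-is-I₃ (gy , false) = refl

run-delete : ∀ u m w → (∀ v → run m v ≡ v) → ∀ v → run (u ++ m ++ w) v ≡ run (u ++ w) v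
run-delete u m w trivial v = begin
  run (u ++ m ++ w) v        ≡⟨ foldr-++ _ v u (m ++ w) ⟩
  run u (run (m ++ w) v)     ≡⟨ cong (run u) (foldr-++ _ v m w) ⟩
  run u (run m (run w v))    ≡⟨ cong (run u) (trivial (run w v)) ⟩
  run u (run w v)            ≡⟨ sym (foldr-++ _ v u w) ⟩
  run (u ++ w) v             ∎
  where open ≡-Reasoning

run-respects : ∀ {u w} → u ≈ₚ w → ∀ v → run u v ≡ run w v
run-respects ≈-refl          v = refl
run-respects (≈-sym p)       v = sym (run-respects p v)
run-respects (≈-trans p q)   v = trans (run-respects p v) (run-respects q v)
run-respects (≈-free u w l)  v = run-delete u (l ∷ inv l ∷ []) w (letter-cancel l) v
run-respects (≈-rel u w)     v = run-delete u (y ∷ y ∷ []) w (letter-cancel y) v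

sound : (u w : Word) → u ≈ₚ w → eval u ≡ eval w
sound u w p = act-faithful (eval u) (eval w) λ v →
  trans (eval-act u v) (trans (run-respects p v) (sym (eval-act w v)))

-- Letters of reduced words; y is an involution.
data Atom : Set where
  X X⁻¹ Y : Atom

_≟_ : (k l : Atom) → Dec (k ≡ l)
X   ≟ X   = yes refl
X   ≟ X⁻¹ = no λ ()
X   ≟ Y   = no λ ()
X⁻¹ ≟ X   = no λ ()
X⁻¹ ≟ X⁻¹ = yes refl
X⁻¹ ≟ Y   = no λ ()
Y   ≟ X   = no λ ()
Y   ≟ X⁻¹ = no λ ()
Y   ≟ Y   = yes refl

inverse : Atom → Atom
inverse X   = X⁻¹
inverse X⁻¹ = X
inverse Y   = Y

letter : Atom → Letter
letter X   = gx , true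
letter X⁻¹ = gx , false
letter Y   = y

spell : List Atom → Word
spell = map letter

Adjacent : Atom → Atom → Set
Adjacent l h = h ≢ inverse l

Reduced : List Atom → Set
Reduced []            = ⊤
Reduced (_ ∷ [])      = ⊤
Reduced (l ∷ h ∷ w)   = Adjacent l h × Reduced (h ∷ w)

Reduced-tail : ∀ h w → Reduced (h ∷ w) → Reduced w
Reduced-tail _ []      _         = tt
Reduced-tail _ (_ ∷ _) (_ , red) = red

fresh : ∀ k h → Σ Atom λ k′ → Adjacent k k′ × k′ ≢ h
fresh X   X   = Y   , (λ ()) , (λ ())
fresh X   X⁻¹ = X   , (λ ()) , (λ ())
fresh X   Y   = X   , (λ ()) , (λ ())
fresh X⁻¹ X   = X⁻¹ , (λ ()) , (λ ())
fresh X⁻¹ X⁻¹ = Y   , (λ ()) , (λ ())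
fresh X⁻¹ Y   = X⁻¹ , (λ ()) , (λ ())
fresh Y   X   = X⁻¹ , (λ ()) , (λ ())
fresh Y   X⁻¹ = X   , (λ ()) , (λ ())
fresh Y   Y   = X   , (λ ()) , (λ ())

end : Atom → List Atom → Atom
end h []      = h
end _ (h ∷ w) = end h w

cons-cong : ∀ l {u w} → u ≈ₚ w → (l ∷ u) ≈ₚ (l ∷ w)
cons-cong l ≈-refl          = ≈-refl
cons-cong l (≈-sym p)       = ≈-sym (cons-cong l p)
cons-cong l (≈-trans p q)   = ≈-trans (cons-cong l p) (cons-cong l q)
cons-cong l (≈-free u w l′) = ≈-free (l ∷ u) w l′
cons-cong l (≈-rel u w)     = ≈-rel (l ∷ u) w

cancel-inverse : ∀ l u → (letter l ∷ letter (inverse l) ∷ u) ≈ₚ u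
cancel-inverse X   u = ≈-free [] u (gx , true)
cancel-inverse X⁻¹ u = ≈-free [] u (gx , false)
cancel-inverse Y   u = ≈-rel [] u

push : Atom → List Atom → List Atom
push l []      = l ∷ []
push l (h ∷ w) with h ≟ inverse l
... | yes _ = w
... | no  _ = l ∷ h ∷ w

push-reduced : ∀ l w → Reduced w → Reduced (push l w)
push-reduced l []      _   = tt
push-reduced l (h ∷ w) red with h ≟ inverse l
... | yes _  = Reduced-tail h w red
... | no adj = adj , red

push-≈ : ∀ l w → (letter l ∷ spell w) ≈ₚ spell (push l w)
push-≈ l []      = ≈-refl
push-≈ l (h ∷ w) with h ≟ inverse l
... | yes refl = cancel-inverse l (spell w)
... | no  _    = ≈-refl

atom : Letter → Atom
atom (gx , true)  = X
atom (gx , false) = X⁻¹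
atom (gy , _)     = Y

-- Replacing a letter by its atom; for y⁻¹ this uses y⁻¹ = y⁻¹ y y = y.
letter-atom : ∀ l u → (l ∷ u) ≈ₚ (letter (atom l) ∷ u)
letter-atom (gx , true)  u = ≈-refl
letter-atom (gx , false) u = ≈-refl
letter-atom (gy , true)  u = ≈-refl
letter-atom (gy , false) u =
  ≈-trans (≈-sym (≈-rel ((gy , false) ∷ []) u)) (≈-free [] (y ∷ u) (gy , false))

normalise : Word → List Atom
normalise []      = []
normalise (l ∷ w) = push (atom l) (normalise w)

normalise-reduced : ∀ w → Reduced (normalise w)
normalise-reduced []      = tt
normalise-reduced (l ∷ w) = push-reduced (atom l) (normalise w) (normalise-reduced w)

normalise-≈ : ∀ w → w ≈ₚ spell (normalise w)
normalise-≈ []      = ≈-refl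
normalise-≈ (l ∷ w) =
  ≈-trans (letter-atom l w)
    (≈-trans (cons-cong _ (normalise-≈ w)) (push-≈ (atom l) (normalise w)))

module PingPong
  {V : Set} (⟦_⟧ : Atom → V → V) (Region : Atom → V → Set)
  (ping      : ∀ {l h v} → Adjacent l h → Region h v → Region l (⟦ l ⟧ v))
  (disjoint  : ∀ {l h v} → l ≢ h → Region l v → Region h v → ⊥)
  (inhabited : ∀ l → Σ V (Region l))
  where

  ⟦_⟧* : List Atom → V → V
  ⟦ w ⟧* v = foldr ⟦_⟧ v w

  lands : ∀ h w {k v} → Reduced (h ∷ w) → Adjacent (end h w) k → Region k v →
          Region h (⟦ h ∷ w ⟧* v)
  lands h []       _            adj r = ping adj r
  lands h (h′ ∷ w) (adj′ , red) adj r = ping adj′ (lands h′ w red adj r)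

  -- Take a point of the region of a letter k allowed after the last letter
  -- but different from h; the word moves it into the disjoint region of h.
  moves : ∀ h w → Reduced (h ∷ w) → Σ V λ v → ⟦ h ∷ w ⟧* v ≢ v
  moves h w red with fresh (end h w) h
  ... | k , adj , k≢h with inhabited k
  ...   | v , v∈k = v , λ fixed →
    disjoint k≢h v∈k (subst (Region h) fixed (lands h w red adj v∈k))

Pos : ℤ → Set
Pos x = + 0 < x

infixl 6 _⊕_
_⊕_ : ∀ {x y} → Pos x → Pos y → Pos (x + y)
p ⊕ q = +-mono-< p q

Pos-≡ : ∀ {x y} → Pos x → y ≡ x → Pos y
Pos-≡ p e = subst Pos (sym e) p

opposite : ∀ {x y} → Pos x → Pos y → x + y ≡ + 0 → ⊥
opposite p q e = <-irrefl refl (subst Pos e (p ⊕ q))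

one : Pos (+ 1)
one = +<+ (ℕ.s≤s ℕ.z≤n)

Inside : ℤ → ℤ → Set
Inside m c = Pos (m - c) × Pos (m + c)

record Cone (a b c : ℤ) : Set where
  constructor cone
  field
    inside-a   : Inside a c
    inside-2ba : Inside (+ 2 * b - a) c

-- Cones are symmetric under c ↦ -c (in both directions, as - - c is not c
-- by computation).
Cone-neg : ∀ {a b c} → Cone a b c → Cone a b (- c)
Cone-neg {a} {b} {c} (cone (p , q) (r , s)) = cone (flip a q , p) (flip (+ 2 * b - a) s , r)
  where
  flip : ∀ m → Pos (m + c) → Pos (m - - c)
  flip m = subst (λ t → Pos (m + t)) (sym (neg-involutive c))

Cone-unneg : ∀ {a b c} → Cone a b (- c) → Cone a b c
Cone-unneg {a} {b} {c} r = subst (Cone a b) (neg-involutive c) (Cone-neg r)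

⟦_⟧ : Atom → V3 → V3
⟦ X   ⟧ (a , b , c) = + 3 * a + + 4 * b , + 2 * a + + 3 * b , c
⟦ X⁻¹ ⟧ (a , b , c) = + 3 * a + - (+ 4) * b , - (+ 2) * a + + 3 * b , c
⟦ Y   ⟧ (a , b , c) = c , b , a

drop-zero : ∀ p q a b c → p * a + q * b + + 0 * c ≡ p * a + q * b
drop-zero = solve-∀

act-block : ∀ p q r s a b c →
  act (mat p q (+ 0) r s (+ 0) (+ 0) (+ 0) (+ 1)) (a , b , c) ≡ (p * a + q * b , r * a + s * b , c)
act-block p q r s a b c = triple≡ (drop-zero p q a b c) (drop-zero r s a b c) (pick₃ a b c)

act-atom : ∀ l v → act (evalL (letter l)) v ≡ ⟦ l ⟧ v
act-atom X   (a , b , c) = act-block (+ 3) (+ 4) (+ 2) (+ 3) a b c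
act-atom X⁻¹ (a , b , c) = act-block (+ 3) (- (+ 4)) (- (+ 2)) (+ 3) a b c
act-atom Y   (a , b , c) = triple≡ (pick₃ a b c) (pick₂ a b c) (pick₁ a b c)

reflect : V3 → V3
reflect (a , b , c) = - a , b , c

reflect-X⁻¹ : ∀ v → reflect (⟦ X⁻¹ ⟧ v) ≡ ⟦ X ⟧ (reflect v)
reflect-X⁻¹ (a , b , c) = cong₂ _,_ (first a b) (cong₂ _,_ (second a b) refl)
  where
  first : ∀ a b → - (+ 3 * a + - (+ 4) * b) ≡ + 3 * - a + + 4 * b
  first = solve-∀
  second : ∀ a b → - (+ 2) * a + + 3 * b ≡ + 2 * - a + + 3 * b
  second = solve-∀

Region : Atom → V3 → Set
Region X   (a , b , c) = Cone a b c
Region X⁻¹ (a , b , c) = Cone (- a) b c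
Region Y   (a , b , c) = Cone c b a ⊎ Cone (- c) b a

reflect-Y : ∀ {v} → Region Y v → Region Y (reflect v)
reflect-Y {a , b , c} (inj₁ r) = inj₁ (Cone-neg r)
reflect-Y {a , b , c} (inj₂ r) = inj₂ (Cone-neg r)

x-cone : ∀ {a b c} → Cone a b c → Cone (+ 3 * a + + 4 * b) (+ 2 * a + + 3 * b) c
x-cone {a} {b} {c} (cone (p₁ , p₂) (p₃ , p₄)) =
  cone (Pos-≡ (p₁ ⊕ p₁ ⊕ p₁ ⊕ p₂ ⊕ p₂ ⊕ p₃ ⊕ p₄) (slack₁ a b c) ,
        Pos-≡ (p₁ ⊕ p₁ ⊕ p₂ ⊕ p₂ ⊕ p₂ ⊕ p₃ ⊕ p₄) (slack₂ a b c))
       (Pos-≡ (p₁ ⊕ p₂ ⊕ p₃) (slack₃ a b c) ,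
        Pos-≡ (p₁ ⊕ p₂ ⊕ p₄) (slack₄ a b c))
  where
  slack₁ : ∀ a b c → + 3 * a + + 4 * b - c
               ≡ a - c + (a - c) + (a - c) + (a + c) + (a + c) + (+ 2 * b - a - c) + (+ 2 * b - a + c)
  slack₁ = solve-∀
  slack₂ : ∀ a b c → + 3 * a + + 4 * b + c
               ≡ a - c + (a - c) + (a + c) + (a + c) + (a + c) + (+ 2 * b - a - c) + (+ 2 * b - a + c)
  slack₂ = solve-∀
  slack₃ : ∀ a b c → + 2 * (+ 2 * a + + 3 * b) - (+ 3 * a + + 4 * b) - c
               ≡ a - c + (a + c) + (+ 2 * b - a - c)
  slack₃ = solve-∀
  slack₄ : ∀ a b c → + 2 * (+ 2 * a + + 3 * b) - (+ 3 * a + + 4 * b) + c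
               ≡ a - c + (a + c) + (+ 2 * b - a + c)
  slack₄ = solve-∀

x-from-y : ∀ {a b c} → Cone c b a → Cone (+ 3 * a + + 4 * b) (+ 2 * a + + 3 * b) c
x-from-y {a} {b} {c} (cone (q₁ , q₂) (q₃ , q₄)) =
  cone (Pos-≡ (q₂ ⊕ q₄ ⊕ q₄) (slack₁ a b c) ,
        Pos-≡ (q₁ ⊕ q₂ ⊕ q₂ ⊕ q₄ ⊕ q₄) (slack₂ a b c))
       (Pos-≡ q₄ (slack₃ a b c) ,
        Pos-≡ (q₂ ⊕ q₂ ⊕ q₃) (slack₄ a b c))
  where
  slack₁ : ∀ a b c → + 3 * a + + 4 * b - c ≡ c + a + (+ 2 * b - c + a) + (+ 2 * b - c + a)
  slack₁ = solve-∀
  slack₂ : ∀ a b c → + 3 * a + + 4 * b + c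
               ≡ c - a + (c + a) + (c + a) + (+ 2 * b - c + a) + (+ 2 * b - c + a)
  slack₂ = solve-∀
  slack₃ : ∀ a b c → + 2 * (+ 2 * a + + 3 * b) - (+ 3 * a + + 4 * b) - c ≡ + 2 * b - c + a
  slack₃ = solve-∀
  slack₄ : ∀ a b c → + 2 * (+ 2 * a + + 3 * b) - (+ 3 * a + + 4 * b) + c
               ≡ c + a + (c + a) + (+ 2 * b - c - a)
  slack₄ = solve-∀

-- B maps the region of y into the region of x; the second half is the first
-- one reflected in c ↦ -c, which commutes with B.
x-from-region-y : ∀ {v} → Region Y v → Region X (⟦ X ⟧ v)
x-from-region-y {a , b , c} (inj₁ r) = x-from-y r
x-from-region-y {a , b , c} (inj₂ r) = Cone-unneg (x-from-y r)

-- The ping-pong property; the cases of x⁻¹ follow from those of x through D.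
ping : ∀ {l h v} → Adjacent l h → Region h v → Region l (⟦ l ⟧ v)
ping {X}   {X}   {a , b , c} _   r        = x-cone r
ping {X}   {X⁻¹}             adj _        = ⊥-elim (adj refl)
ping {X}   {Y}               _   r        = x-from-region-y r
ping {X⁻¹} {X}               adj _        = ⊥-elim (adj refl)
ping {X⁻¹} {X⁻¹} {v}         _   r        = subst (Region X) (sym (reflect-X⁻¹ v)) (x-cone r)
ping {X⁻¹} {Y}   {v}         _   r        =
  subst (Region X) (sym (reflect-X⁻¹ v)) (x-from-region-y (reflect-Y r))
ping {Y}   {X}   {a , b , c} _   r        = inj₁ r
ping {Y}   {X⁻¹} {a , b , c} _   r        = inj₂ r
ping {Y}   {Y}               adj _        = ⊥-elim (adj refl)

-- Pairwise disjointness: each pair of regions demands opposite signs of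
-- some linear form.
x-x⁻¹-disjoint : ∀ {a b c} → Cone a b c → Cone (- a) b c → ⊥
x-x⁻¹-disjoint {a} {b} {c} (cone (p , _) _) (cone (_ , q) _) = opposite p q (cancel a c)
  where
  cancel : ∀ a c → a - c + (- a + c) ≡ + 0
  cancel = solve-∀

x-y-disjoint : ∀ {a b c} → Cone a b c → Region Y (a , b , c) → ⊥
x-y-disjoint {a} {b} {c} (cone (p , _) _) (inj₁ (cone (q , _) _)) = opposite p q (cancel a c)
  where
  cancel : ∀ a c → a - c + (c - a) ≡ + 0
  cancel = solve-∀
x-y-disjoint {a} {b} {c} (cone (_ , p) _) (inj₂ (cone (q , _) _)) = opposite p q (cancel a c)
  where
  cancel : ∀ a c → a + c + (- c - a) ≡ + 0
  cancel = solve-∀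

x⁻¹-y-disjoint : ∀ {a b c} → Cone (- a) b c → Region Y (a , b , c) → ⊥
x⁻¹-y-disjoint {a} {b} {c} (cone (p , _) _) (inj₁ (cone (_ , q) _)) = opposite p q (cancel a c)
  where
  cancel : ∀ a c → - a - c + (c + a) ≡ + 0
  cancel = solve-∀
x⁻¹-y-disjoint {a} {b} {c} (cone (_ , p) _) (inj₂ (cone (_ , q) _)) = opposite p q (cancel a c)
  where
  cancel : ∀ a c → - a + c + (- c + a) ≡ + 0
  cancel = solve-∀

regions-disjoint : ∀ {l h v} → l ≢ h → Region l v → Region h v → ⊥
regions-disjoint {X}   {X}               l≢h _ _ = l≢h refl
regions-disjoint {X}   {X⁻¹} {a , b , c} _   r s = x-x⁻¹-disjoint r s
regions-disjoint {X}   {Y}   {a , b , c} _   r s = x-y-disjoint r s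
regions-disjoint {X⁻¹} {X}   {a , b , c} _   r s = x-x⁻¹-disjoint s r
regions-disjoint {X⁻¹} {X⁻¹}             l≢h _ _ = l≢h refl
regions-disjoint {X⁻¹} {Y}   {a , b , c} _   r s = x⁻¹-y-disjoint r s
regions-disjoint {Y}   {X}   {a , b , c} _   r s = x-y-disjoint s r
regions-disjoint {Y}   {X⁻¹} {a , b , c} _   r s = x⁻¹-y-disjoint s r
regions-disjoint {Y}   {Y}               l≢h _ _ = l≢h refl

unit-cone : Cone (+ 1) (+ 1) (+ 0)
unit-cone = cone (one , one) (one , one)

inhabited : ∀ l → Σ V3 (Region l)
inhabited X   = (+ 1 , + 1 , + 0)      , unit-cone
inhabited X⁻¹ = (- (+ 1) , + 1 , + 0)  , unit-cone
inhabited Y   = (+ 0 , + 1 , + 1)      , inj₁ unit-cone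

open PingPong ⟦_⟧ Region ping regions-disjoint inhabited

run-spell : ∀ w v → run (spell w) v ≡ ⟦ w ⟧* v
run-spell []      v = refl
run-spell (l ∷ w) v = trans (act-atom l (run (spell w) v)) (cong ⟦ l ⟧ (run-spell w v))

reduced-nontrivial : ∀ h w → Reduced (h ∷ w) → eval (spell (h ∷ w)) ≢ I₃
reduced-nontrivial h w red trivial with moves h w red
... | v , moved = moved (begin
  ⟦ h ∷ w ⟧* v                  ≡⟨ sym (run-spell (h ∷ w) v) ⟩
  run (spell (h ∷ w)) v         ≡⟨ sym (eval-act (spell (h ∷ w)) v) ⟩
  act (eval (spell (h ∷ w))) v  ≡⟨ cong (λ M → act M v) trivial ⟩
  act I₃ v                      ≡⟨ act-I₃ v ⟩
  v                             ∎)
  where open ≡-Reasoning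

theorem1p5 : ((u v : Word) → u ≈ₚ v → eval u ≡ eval v)
             × ((w : Word) → eval w ≡ I₃ → w ≈ₚ [])
theorem1p5 = sound , complete
  where
  -- Reduce w; the normal form must be empty, since a nonempty one would
  -- evaluate to eval w = I₃.
  complete : (w : Word) → eval w ≡ I₃ → w ≈ₚ []
  complete w trivial with normalise w | normalise-reduced w | normalise-≈ w
  ... | []    | _   | w≈[]  = w≈[]
  ... | h ∷ r | red | w≈h∷r =
    ⊥-elim (reduced-nontrivial h r red (trans (sym (sound w (spell (h ∷ r)) w≈h∷r)) trivial))
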